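{- $c_2\le 0.88999$, where $c_2:=\lim_{n\to\infty}\max_{z\in\{0,1\}^n}\frac{\mathbb{E}_{x\sim\{0,1\}^n}[|\mathsf{LCS}(x,z)|]}{n}$ with $x$ uniform over $\{0,1\}^n$.
   Context: $|\mathsf{LCS}(u,v)|$ denotes the length of a longest common subsequence of strings $u,v$. The limit defining $c_2$ exists (by superadditivity and Fekete's lemma). -}

module Defs where

open import Data.Bool using (Bool; true; false)
import Data.Bool.Properties as BoolP
open import Data.Nat using (ℕ; zero; suc; _⊔_; _+_)
open import Data.List using (List; []; _∷_; _++_; map; length; foldr; filter)
open import Data.Nat.ListAction using (sum)
open import Data.List.Relation.Binary.Sublist.DecPropositional BoolP._≟_ using (_⊆?_)

Str : Set
Str = List Bool

subsequences : {A : Set} → List A → List (List A)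
subsequences []       = [] ∷ []
subsequences (a ∷ u) = subsequences u ++ map (a ∷_) (subsequences u)

maxList : List ℕ → ℕ
maxList = foldr _⊔_ 0

lcsLen : Str → Str → ℕ
lcsLen u v = maxList (map length (filter (_⊆? v) (subsequences u)))

allStrings : ℕ → List Str
allStrings zero    = [] ∷ []
allStrings (suc n) = map (false ∷_) (allStrings n) ++ map (true ∷_) (allStrings n)

-- Σ_{x ∈ {0,1}^n} |LCS(x,z)|  ( = 2^n · E_x[|LCS(x,z)|] ).
totalLCS : (n : ℕ) → Str → ℕ
totalLCS n z = sum (map (λ x → lcsLen x z) (allStrings n))

{-# OPTIONS --safe #-}
-- If |LCS(x,z)| ≥ L then x contains one of the length-L sublists w of z,
-- so the number S of strings x ∈ {0,1}^n with |LCS(x,z)| ≥ L is at most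
-- (number of length-L sublists of z) · (number of x containing a fixed w of length L),
-- and both factors are at most Σ_{j ≤ n-L} C(n, j) ≤ (p + s)^n / (p^L s^(n-L)) whenever s ≤ p.
-- Taking L ≈ p n / (p + s), this gives S ≤ 2^(n (2 H(p / (p + s)) + o(1))), which is o(2^n) as soon as
-- 2 H(p / (p + s)) < 1. Then E|LCS(x,z)| ≤ L + n S / 2^n = (p / (p + s) + o(1)) n; p = 364, s = 45 suffice.
module Submission where

open import Defs
open import Data.Bool using (true; false)
import Data.Bool.Properties as Bool
open import Data.Empty using (⊥-elim)
open import Data.List using (List; []; _∷_; _++_; map; length; filter; take)
open import Data.List.Properties using (foldr-preservesᵇ; length-map; length-++; length-take; map-++; map-∘)
open import Data.List.Membership.Propositional using (_∈_)
open import Data.List.Membership.Propositional.Properties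
  using (∈-map⁻; ∈-map⁺; ∈-++⁻; ∈-++⁺ˡ; ∈-++⁺ʳ; ∈-filter⁻; foldr-selective)
open import Data.List.Relation.Unary.Any using (here; there)
import Data.List.Relation.Unary.All as All
open import Data.List.Relation.Binary.Sublist.Propositional using (_⊆_)
open import Data.List.Relation.Binary.Sublist.Heterogeneous using ([]; _∷ʳ_; _∷_; minimum)
open import Data.List.Relation.Binary.Sublist.Heterogeneous.Properties
  using (length-mono-≤; take-Sublist; ∷⁻; ∷ʳ⁻)
open import Data.List.Relation.Binary.Sublist.DecPropositional Bool._≟_ using (_⊆?_)
open import Data.Nat
open import Data.Nat.DivMod using (_/_; _%_; m≡m%n+[m/n]*n; m%n<n; m/n*n≤m; m*n/n≡m; /-monoˡ-≤)
open import Data.Nat.ListAction using (sum)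
open import Data.Nat.ListAction.Properties using (sum-++)
open import Data.Nat.Properties
open import Data.Nat.Tactic.RingSolver using (solve-∀)
open import Data.Product using (∃-syntax; _×_; _,_)
open import Data.Sum using (inj₁; inj₂)
open import Function using (_∘_)
open import Relation.Nullary using (Dec; yes; no; ¬_)
open import Relation.Binary.PropositionalEquality

private
  variable
    A B : Set

∑ : List A → (A → ℕ) → ℕ
∑ xs f = sum (map f xs)

syntax ∑ xs (λ x → e) = ∑[ x ← xs ] e

∑-++ : ∀ (xs ys : List A) f → ∑ (xs ++ ys) f ≡ ∑ xs f + ∑ ys f
∑-++ xs ys f = trans (cong sum (map-++ f xs ys)) (sum-++ (map f xs) (map f ys))

∑-map : ∀ (g : A → B) xs f → ∑ (map g xs) f ≡ ∑ xs (f ∘ g)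
∑-map g xs f = cong sum (sym (map-∘ xs))

∑-distrib-+ : ∀ (xs : List A) f g → ∑[ x ← xs ] (f x + g x) ≡ ∑ xs f + ∑ xs g
∑-distrib-+ []       f g = refl
∑-distrib-+ (x ∷ xs) f g = begin
  f x + g x + ∑[ y ← xs ] (f y + g y) ≡⟨ cong (f x + g x +_) (∑-distrib-+ xs f g) ⟩
  f x + g x + (∑ xs f + ∑ xs g)       ≡⟨ +-+-interchange (f x) (g x) _ _ ⟩
  f x + ∑ xs f + (g x + ∑ xs g)       ∎
  where
  open ≡-Reasoning
  +-+-interchange : ∀ a b c d → a + b + (c + d) ≡ a + c + (b + d)
  +-+-interchange = solve-∀

∑-*ˡ : ∀ (xs : List A) c f → ∑[ x ← xs ] (c * f x) ≡ c * ∑ xs f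
∑-*ˡ []       c f = sym (*-zeroʳ c)
∑-*ˡ (x ∷ xs) c f = trans (cong (c * f x +_) (∑-*ˡ xs c f)) (sym (*-distribˡ-+ c (f x) (∑ xs f)))

∑-const : ∀ (xs : List A) c → ∑[ _ ← xs ] c ≡ length xs * c
∑-const []       c = refl
∑-const (x ∷ xs) c = cong (c +_) (∑-const xs c)

∑-mono-≤ : ∀ (xs : List A) {f g} → (∀ {x} → x ∈ xs → f x ≤ g x) → ∑ xs f ≤ ∑ xs g
∑-mono-≤ []       f≤g = z≤n
∑-mono-≤ (x ∷ xs) f≤g = +-mono-≤ (f≤g (here refl)) (∑-mono-≤ xs (f≤g ∘ there))

∈⇒≤∑ : ∀ {xs : List A} {x} f → x ∈ xs → f x ≤ ∑ xs f
∈⇒≤∑ {xs = _ ∷ xs} f (here refl) = m≤m+n _ (∑ xs f)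
∈⇒≤∑ {xs = y ∷ xs} f (there x∈) = ≤-trans (∈⇒≤∑ f x∈) (m≤n+m _ (f y))

∑-comm : ∀ (xs : List A) (ys : List B) (f : A → B → ℕ) →
         ∑[ x ← xs ] ∑[ y ← ys ] f x y ≡ ∑[ y ← ys ] ∑[ x ← xs ] f x y
∑-comm []       ys f = sym (trans (∑-const ys 0) (*-zeroʳ (length ys)))
∑-comm (x ∷ xs) ys f = begin
  ∑ ys (f x) + ∑[ x′ ← xs ] ∑ ys (f x′)     ≡⟨ cong (∑ ys (f x) +_) (∑-comm xs ys f) ⟩
  ∑ ys (f x) + ∑[ y ← ys ] ∑[ x′ ← xs ] f x′ y ≡⟨ sym (∑-distrib-+ ys (f x) (λ y → ∑[ x′ ← xs ] f x′ y)) ⟩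
  ∑[ y ← ys ] (f x y + ∑[ x′ ← xs ] f x′ y) ∎
  where open ≡-Reasoning

𝟙 : {P : Set} → Dec P → ℕ
𝟙 (yes _) = 1
𝟙 (no _)  = 0

module _ {P Q : Set} where

  𝟙-mono-≤ : (P → Q) → (p? : Dec P) (q? : Dec Q) → 𝟙 p? ≤ 𝟙 q?
  𝟙-mono-≤ P⇒Q (yes p) (yes _) = ≤-refl
  𝟙-mono-≤ P⇒Q (yes p) (no ¬q) = ⊥-elim (¬q (P⇒Q p))
  𝟙-mono-≤ P⇒Q (no _)  q?      = z≤n

𝟙-accept : ∀ {P : Set} → P → (p? : Dec P) → 𝟙 p? ≡ 1
𝟙-accept p (yes _) = refl
𝟙-accept p (no ¬p) = ⊥-elim (¬p p)

𝟙-reject : ∀ {P : Set} → ¬ P → (p? : Dec P) → 𝟙 p? ≡ 0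
𝟙-reject ¬p (yes p) = ⊥-elim (¬p p)
𝟙-reject ¬p (no _)  = refl

^-distribʳ-* : ∀ m n o → (m * n) ^ o ≡ m ^ o * n ^ o
^-distribʳ-* m n zero    = refl
^-distribʳ-* m n (suc o) = trans (cong (m * n *_) (^-distribʳ-* m n o)) ([m*n]*[o*p]≡[m*o]*[n*p] m n (m ^ o) (n ^ o))

allStrings-length : ∀ n {x} → x ∈ allStrings n → length x ≡ n
allStrings-length zero    (here refl) = refl
allStrings-length (suc n) x∈ with ∈-++⁻ (map (false ∷_) (allStrings n)) x∈
... | inj₁ x∈₀ with ∈-map⁻ (false ∷_) x∈₀
...   | y , y∈ , refl = cong suc (allStrings-length n y∈)
allStrings-length (suc n) x∈ | inj₂ x∈₁ with ∈-map⁻ (true ∷_) x∈₁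
...   | y , y∈ , refl = cong suc (allStrings-length n y∈)

length-allStrings : ∀ n → length (allStrings n) ≡ 2 ^ n
length-allStrings zero    = refl
length-allStrings (suc n) = begin
  length (map (false ∷_) Sₙ ++ map (true ∷_) Sₙ)         ≡⟨ length-++ (map (false ∷_) Sₙ) ⟩
  length (map (false ∷_) Sₙ) + length (map (true ∷_) Sₙ) ≡⟨ cong₂ _+_ (length-map _ Sₙ) (length-map _ Sₙ) ⟩
  length Sₙ + length Sₙ                                  ≡⟨ cong (λ k → k + k) (length-allStrings n) ⟩
  2 ^ n + 2 ^ n                                          ≡⟨ cong (2 ^ n +_) (sym (+-identityʳ (2 ^ n))) ⟩
  2 ^ suc n                                              ∎
  where
  open ≡-Reasoning
  Sₙ : List Str
  Sₙ = allStrings n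

-- binomialTail l m = Σ_{j ≤ m} C(l + m, j), the number of strings of length l + m containing a fixed
-- string of length l as a subsequence.
binomialTail : ℕ → ℕ → ℕ
binomialTail zero    m       = 2 ^ m
binomialTail (suc l) zero    = binomialTail l zero
binomialTail (suc l) (suc m) = binomialTail l (suc m) + binomialTail (suc l) m

binomialTail-weighted : ∀ {p s} → s ≤ p → ∀ l m → binomialTail l m * (p ^ l * s ^ m) ≤ (p + s) ^ (l + m)
binomialTail-weighted {p} {s} s≤p zero m = begin
  2 ^ m * (1 * s ^ m) ≡⟨ cong (2 ^ m *_) (*-identityˡ (s ^ m)) ⟩
  2 ^ m * s ^ m       ≡⟨ sym (^-distribʳ-* 2 s m) ⟩
  (2 * s) ^ m         ≤⟨ ^-monoˡ-≤ m (≤-trans (≤-reflexive (cong (s +_) (+-identityʳ s))) (+-monoˡ-≤ s s≤p)) ⟩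
  (p + s) ^ m         ∎
  where open ≤-Reasoning
binomialTail-weighted {p} {s} s≤p (suc l) zero = begin
  G * (p * p ^ l * 1)             ≡⟨ regroup G p (p ^ l) ⟩
  p * (G * (p ^ l * 1))           ≤⟨ *-monoʳ-≤ p (binomialTail-weighted s≤p l zero) ⟩
  p * (p + s) ^ (l + 0)           ≤⟨ *-monoˡ-≤ _ (m≤m+n p s) ⟩
  (p + s) * (p + s) ^ (l + 0)     ∎
  where
  open ≤-Reasoning
  G : ℕ
  G = binomialTail l zero
  regroup : ∀ g p x → g * (p * x * 1) ≡ p * (g * (x * 1))
  regroup = solve-∀
binomialTail-weighted {p} {s} s≤p (suc l) (suc m) = begin
  (G₁ + G₂) * (p * p ^ l * (s * s ^ m))
    ≡⟨ regroup G₁ G₂ p (p ^ l) s (s ^ m) ⟩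
  p * (G₁ * (p ^ l * s ^ suc m)) + s * (G₂ * (p ^ suc l * s ^ m))
    ≤⟨ +-mono-≤ (*-monoʳ-≤ p (binomialTail-weighted s≤p l (suc m)))
                (*-monoʳ-≤ s (binomialTail-weighted s≤p (suc l) m)) ⟩
  p * (p + s) ^ (l + suc m) + s * (p + s) ^ suc (l + m)
    ≡⟨ cong (λ k → p * (p + s) ^ k + s * (p + s) ^ suc (l + m)) (+-suc l m) ⟩
  p * (p + s) ^ suc (l + m) + s * (p + s) ^ suc (l + m)
    ≡⟨ sym (*-distribʳ-+ _ p s) ⟩
  (p + s) * (p + s) ^ suc (l + m)
    ≡⟨ cong (λ k → (p + s) * (p + s) ^ k) (sym (+-suc l m)) ⟩
  (p + s) * (p + s) ^ (l + suc m) ∎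
  where
  open ≤-Reasoning
  G₁ G₂ : ℕ
  G₁ = binomialTail l (suc m)
  G₂ = binomialTail (suc l) m
  regroup : ∀ a b p x s y → (a + b) * (p * x * (s * y)) ≡ p * (a * (x * (s * y))) + s * (b * (p * x * y))
  regroup = solve-∀

supersequenceCount : Str → ℕ → ℕ
supersequenceCount w n = ∑[ x ← allStrings n ] 𝟙 (w ⊆? x)

supersequenceCount-[] : ∀ n → supersequenceCount [] n ≡ 2 ^ n
supersequenceCount-[] n = begin
  ∑[ x ← allStrings n ] 1   ≡⟨ ∑-const (allStrings n) 1 ⟩
  length (allStrings n) * 1 ≡⟨ *-identityʳ _ ⟩
  length (allStrings n)     ≡⟨ length-allStrings n ⟩
  2 ^ n                     ∎
  where open ≡-Reasoning

supersequenceCount-short : ∀ w n → n < length w → supersequenceCount w n ≡ 0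
supersequenceCount-short w n n<∣w∣ = n≤0⇒n≡0 (begin
  ∑[ x ← allStrings n ] 𝟙 (w ⊆? x) ≤⟨ ∑-mono-≤ (allStrings n) (λ x∈ → ≤-reflexive (𝟙-reject (too-long x∈) _)) ⟩
  ∑[ x ← allStrings n ] 0          ≡⟨ ∑-const (allStrings n) 0 ⟩
  length (allStrings n) * 0        ≡⟨ *-zeroʳ (length (allStrings n)) ⟩
  0                                ∎)
  where
  open ≤-Reasoning
  too-long : ∀ {x} → x ∈ allStrings n → ¬ (w ⊆ x)
  too-long x∈ w⊆x = <⇒≱ n<∣w∣ (≤-trans (length-mono-≤ w⊆x) (≤-reflexive (allStrings-length n x∈)))

-- A string b ∷ x containing c ∷ w either starts with c and x contains w, or x contains c ∷ w.
𝟙-⊆-∷ : ∀ c w x → 𝟙 (c ∷ w ⊆? false ∷ x) + 𝟙 (c ∷ w ⊆? true ∷ x) ≤ 𝟙 (w ⊆? x) + 𝟙 (c ∷ w ⊆? x)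
𝟙-⊆-∷ false w x = +-mono-≤ (𝟙-mono-≤ ∷⁻ (false ∷ w ⊆? false ∷ x) (w ⊆? x))
                            (𝟙-mono-≤ (∷ʳ⁻ λ ()) (false ∷ w ⊆? true ∷ x) (false ∷ w ⊆? x))
𝟙-⊆-∷ true  w x = ≤-trans (+-mono-≤ (𝟙-mono-≤ (∷ʳ⁻ λ ()) (true ∷ w ⊆? false ∷ x) (true ∷ w ⊆? x))
                                    (𝟙-mono-≤ ∷⁻ (true ∷ w ⊆? true ∷ x) (w ⊆? x)))
                          (≤-reflexive (+-comm (𝟙 (true ∷ w ⊆? x)) (𝟙 (w ⊆? x))))

supersequenceCount-∷ : ∀ c w n →
  supersequenceCount (c ∷ w) (suc n) ≤ supersequenceCount w n + supersequenceCount (c ∷ w) n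
supersequenceCount-∷ c w n = begin
  ∑ (map (false ∷_) Sₙ ++ map (true ∷_) Sₙ) f
    ≡⟨ ∑-++ (map (false ∷_) Sₙ) _ f ⟩
  ∑ (map (false ∷_) Sₙ) f + ∑ (map (true ∷_) Sₙ) f
    ≡⟨ cong₂ _+_ (∑-map (false ∷_) Sₙ f) (∑-map (true ∷_) Sₙ f) ⟩
  ∑[ x ← Sₙ ] f (false ∷ x) + ∑[ x ← Sₙ ] f (true ∷ x)
    ≡⟨ sym (∑-distrib-+ Sₙ _ _) ⟩
  ∑[ x ← Sₙ ] (f (false ∷ x) + f (true ∷ x))
    ≤⟨ ∑-mono-≤ Sₙ (λ {x} _ → 𝟙-⊆-∷ c w x) ⟩
  ∑[ x ← Sₙ ] (𝟙 (w ⊆? x) + f x)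
    ≡⟨ ∑-distrib-+ Sₙ _ _ ⟩
  supersequenceCount w n + supersequenceCount (c ∷ w) n ∎
  where
  open ≤-Reasoning
  Sₙ : List Str
  Sₙ = allStrings n
  f : Str → ℕ
  f x = 𝟙 (c ∷ w ⊆? x)

supersequenceCount≤binomialTail : ∀ w m → supersequenceCount w (length w + m) ≤ binomialTail (length w) m
supersequenceCount≤binomialTail []      m = ≤-reflexive (supersequenceCount-[] m)
supersequenceCount≤binomialTail (c ∷ w) zero = begin
  supersequenceCount (c ∷ w) (suc (length w + 0))
    ≤⟨ supersequenceCount-∷ c w (length w + 0) ⟩
  supersequenceCount w (length w + 0) + supersequenceCount (c ∷ w) (length w + 0)
    ≡⟨ cong (supersequenceCount w (length w + 0) +_) (supersequenceCount-short (c ∷ w) _ (s≤s (≤-reflexive (+-identityʳ _)))) ⟩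
  supersequenceCount w (length w + 0) + 0
    ≤⟨ ≤-reflexive (+-identityʳ _) ⟩
  supersequenceCount w (length w + 0)
    ≤⟨ supersequenceCount≤binomialTail w zero ⟩
  binomialTail (length w) zero ∎
  where open ≤-Reasoning
supersequenceCount≤binomialTail (c ∷ w) (suc m) = begin
  supersequenceCount (c ∷ w) (suc (length w + suc m))
    ≤⟨ supersequenceCount-∷ c w (length w + suc m) ⟩
  supersequenceCount w (length w + suc m) + supersequenceCount (c ∷ w) (length w + suc m)
    ≡⟨ cong (λ k → supersequenceCount w (length w + suc m) + supersequenceCount (c ∷ w) k) (+-suc (length w) m) ⟩
  supersequenceCount w (length w + suc m) + supersequenceCount (c ∷ w) (length (c ∷ w) + m)
    ≤⟨ +-mono-≤ (supersequenceCount≤binomialTail w (suc m)) (supersequenceCount≤binomialTail (c ∷ w) m) ⟩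
  binomialTail (length w) (suc m) + binomialTail (suc (length w)) m ∎
  where open ≤-Reasoning

sublistsOfLength : ℕ → List A → List (List A)
sublistsOfLength zero    xs       = [] ∷ []
sublistsOfLength (suc l) []       = []
sublistsOfLength (suc l) (x ∷ xs) = map (x ∷_) (sublistsOfLength l xs) ++ sublistsOfLength (suc l) xs

⊆⇒∈sublistsOfLength : ∀ {ys xs : List A} → ys ⊆ xs → ys ∈ sublistsOfLength (length ys) xs
⊆⇒∈sublistsOfLength []                  = here refl
⊆⇒∈sublistsOfLength {ys = []}    (_ ∷ʳ _) = here refl
⊆⇒∈sublistsOfLength {ys = _ ∷ _} (x ∷ʳ p) = ∈-++⁺ʳ (map (x ∷_) _) (⊆⇒∈sublistsOfLength p)
⊆⇒∈sublistsOfLength (refl ∷ p)          = ∈-++⁺ˡ (∈-map⁺ _ (⊆⇒∈sublistsOfLength p))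

∈sublistsOfLength⇒length : ∀ l (xs : List A) {ys} → ys ∈ sublistsOfLength l xs → length ys ≡ l
∈sublistsOfLength⇒length zero    xs       (here refl) = refl
∈sublistsOfLength⇒length (suc l) (x ∷ xs) ys∈ with ∈-++⁻ (map (x ∷_) (sublistsOfLength l xs)) ys∈
... | inj₁ ys∈₁ with ∈-map⁻ (x ∷_) ys∈₁
...   | zs , zs∈ , refl = cong suc (∈sublistsOfLength⇒length l xs zs∈)
∈sublistsOfLength⇒length (suc l) (x ∷ xs) ys∈ | inj₂ ys∈₂ = ∈sublistsOfLength⇒length (suc l) xs ys∈₂

sublistsOfLength-short : ∀ l (xs : List A) → length xs < l → sublistsOfLength l xs ≡ []
sublistsOfLength-short (suc l) []       _            = refl
sublistsOfLength-short (suc l) (x ∷ xs) (s≤s ∣xs∣<l)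
  rewrite sublistsOfLength-short l xs ∣xs∣<l | sublistsOfLength-short (suc l) xs (m<n⇒m<1+n ∣xs∣<l) = refl

length-sublistsOfLength≤binomialTail : ∀ l m (xs : List A) → length xs ≡ l + m →
                                       length (sublistsOfLength l xs) ≤ binomialTail l m
length-sublistsOfLength≤binomialTail zero    m xs       _ = m^n>0 2 m
length-sublistsOfLength≤binomialTail (suc l) m []       ()
length-sublistsOfLength≤binomialTail (suc l) m (x ∷ xs) ∣xs∣≡ = begin
  length (map (x ∷_) (sublistsOfLength l xs) ++ sublistsOfLength (suc l) xs)
    ≡⟨ length-++ (map (x ∷_) (sublistsOfLength l xs)) ⟩
  length (map (x ∷_) (sublistsOfLength l xs)) + length (sublistsOfLength (suc l) xs)
    ≡⟨ cong (_+ length (sublistsOfLength (suc l) xs)) (length-map (x ∷_) (sublistsOfLength l xs)) ⟩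
  length (sublistsOfLength l xs) + length (sublistsOfLength (suc l) xs)
    ≤⟨ step m (suc-injective ∣xs∣≡) ⟩
  binomialTail (suc l) m ∎
  where
  open ≤-Reasoning
  step : ∀ m → length xs ≡ l + m →
         length (sublistsOfLength l xs) + length (sublistsOfLength (suc l) xs) ≤ binomialTail (suc l) m
  step zero    ∣xs∣≡ = begin
    length (sublistsOfLength l xs) + length (sublistsOfLength (suc l) xs)
      ≡⟨ cong (λ ys → length (sublistsOfLength l xs) + length ys)
              (sublistsOfLength-short (suc l) xs (s≤s (≤-reflexive (trans ∣xs∣≡ (+-identityʳ l))))) ⟩
    length (sublistsOfLength l xs) + 0
      ≡⟨ +-identityʳ _ ⟩
    length (sublistsOfLength l xs)
      ≤⟨ length-sublistsOfLength≤binomialTail l zero xs ∣xs∣≡ ⟩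
    binomialTail l zero ∎
  step (suc m) ∣xs∣≡ = +-mono-≤ (length-sublistsOfLength≤binomialTail l (suc m) xs ∣xs∣≡)
                                (length-sublistsOfLength≤binomialTail (suc l) m xs (trans ∣xs∣≡ (+-suc l m)))

∈subsequences⇒⊆ : ∀ (xs : List A) {ys} → ys ∈ subsequences xs → ys ⊆ xs
∈subsequences⇒⊆ []       (here refl) = []
∈subsequences⇒⊆ (x ∷ xs) ys∈ with ∈-++⁻ (subsequences xs) ys∈
... | inj₁ ys∈₁ = x ∷ʳ ∈subsequences⇒⊆ xs ys∈₁
... | inj₂ ys∈₂ with ∈-map⁻ (x ∷_) ys∈₂
...   | zs , zs∈ , refl = refl ∷ ∈subsequences⇒⊆ xs zs∈

lcsLen≤length : ∀ x z → lcsLen x z ≤ length x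
lcsLen≤length x z = foldr-preservesᵇ ⊔-lub z≤n (All.tabulate bounded)
  where
  bounded : ∀ {k} → k ∈ map length (filter (_⊆? z) (subsequences x)) → k ≤ length x
  bounded k∈ with ∈-map⁻ length k∈
  ... | w , w∈ , refl with ∈-filter⁻ (_⊆? z) w∈
  ...   | w∈subs , _ = length-mono-≤ (∈subsequences⇒⊆ x w∈subs)

lcsLen-witness : ∀ x z {L} → L ≤ lcsLen x z → ∃[ w ] (w ⊆ x × w ⊆ z × length w ≡ L)
lcsLen-witness x z {L} L≤lcs with foldr-selective ⊔-sel 0 (map length (filter (_⊆? z) (subsequences x)))
... | inj₁ lcs≡0 rewrite lcs≡0 | n≤0⇒n≡0 L≤lcs = [] , minimum x , minimum z , refl
... | inj₂ lcs∈ with ∈-map⁻ length lcs∈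
...   | w , w∈ , lcs≡∣w∣ with ∈-filter⁻ (_⊆? z) w∈
...     | w∈subs , w⊆z = take L w , take-Sublist L (∈subsequences⇒⊆ x w∈subs) , take-Sublist L w⊆z ,
                         trans (length-take L w) (m≤n⇒m⊓n≡m (≤-trans L≤lcs (≤-reflexive lcs≡∣w∣)))

lcsCount≥ : ℕ → ℕ → Str → ℕ
lcsCount≥ L n z = ∑[ x ← allStrings n ] 𝟙 (L ≤? lcsLen x z)

totalLCS≤ : ∀ n z L → totalLCS n z ≤ 2 ^ n * L + n * lcsCount≥ L n z
totalLCS≤ n z L = begin
  ∑[ x ← allStrings n ] lcsLen x z                          ≤⟨ ∑-mono-≤ (allStrings n) pointwise ⟩
  ∑[ x ← allStrings n ] (L + n * 𝟙 (L ≤? lcsLen x z))       ≡⟨ ∑-distrib-+ (allStrings n) _ _ ⟩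
  ∑[ _ ← allStrings n ] L + ∑[ x ← allStrings n ] (n * _)   ≡⟨ cong₂ _+_ (∑-const (allStrings n) L) (∑-*ˡ (allStrings n) n _) ⟩
  length (allStrings n) * L + n * lcsCount≥ L n z           ≡⟨ cong (λ k → k * L + n * lcsCount≥ L n z) (length-allStrings n) ⟩
  2 ^ n * L + n * lcsCount≥ L n z                           ∎
  where
  open ≤-Reasoning
  pointwise : ∀ {x} → x ∈ allStrings n → lcsLen x z ≤ L + n * 𝟙 (L ≤? lcsLen x z)
  pointwise {x} x∈ with L ≤? lcsLen x z
  ... | yes _ = ≤-trans (lcsLen≤length x z)
                        (≤-trans (≤-reflexive (trans (allStrings-length n x∈) (sym (*-identityʳ n)))) (m≤n+m _ L))
  ... | no L≰lcs = ≤-trans (<⇒≤ (≰⇒> L≰lcs)) (≤-reflexive (sym (trans (cong (L +_) (*-zeroʳ n)) (+-identityʳ L))))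

lcsCount≥≤∑supersequenceCount : ∀ L n z → lcsCount≥ L n z ≤ ∑[ w ← sublistsOfLength L z ] supersequenceCount w n
lcsCount≥≤∑supersequenceCount L n z = begin
  ∑[ x ← allStrings n ] 𝟙 (L ≤? lcsLen x z)       ≤⟨ ∑-mono-≤ (allStrings n) (λ {x} _ → covered x) ⟩
  ∑[ x ← allStrings n ] ∑[ w ← W ] 𝟙 (w ⊆? x)     ≡⟨ ∑-comm (allStrings n) W (λ x w → 𝟙 (w ⊆? x)) ⟩
  ∑[ w ← W ] supersequenceCount w n             ∎
  where
  open ≤-Reasoning
  W : List Str
  W = sublistsOfLength L z
  covered : ∀ x → 𝟙 (L ≤? lcsLen x z) ≤ ∑[ w ← W ] 𝟙 (w ⊆? x)
  covered x with L ≤? lcsLen x z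
  ... | no _       = z≤n
  ... | yes L≤lcs with lcsLen-witness x z L≤lcs
  ...   | w , w⊆x , w⊆z , refl =
    ≤-trans (≤-reflexive (sym (𝟙-accept w⊆x (w ⊆? x)))) (∈⇒≤∑ (λ w → 𝟙 (w ⊆? x)) (⊆⇒∈sublistsOfLength w⊆z))

lcsCount≥-weighted : ∀ {p s} → s ≤ p → ∀ {L m n} z → L + m ≡ n → length z ≡ n →
                     lcsCount≥ L n z * ((p ^ L * s ^ m) * (p ^ L * s ^ m)) ≤ (p + s) ^ n * (p + s) ^ n
lcsCount≥-weighted {p} {s} s≤p {L} {m} {n} z L+m≡n ∣z∣≡n = begin
  lcsCount≥ L n z * (X * X)              ≤⟨ *-monoˡ-≤ (X * X) (lcsCount≥≤∑supersequenceCount L n z) ⟩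
  ∑[ w ← W ] supersequenceCount w n * (X * X) ≤⟨ *-monoˡ-≤ (X * X) (∑-mono-≤ W bounded) ⟩
  ∑[ _ ← W ] G * (X * X)                 ≡⟨ cong (_* (X * X)) (∑-const W G) ⟩
  length W * G * (X * X)                 ≡⟨ [m*n]*[o*p]≡[m*o]*[n*p] (length W) G X X ⟩
  length W * X * (G * X)                 ≤⟨ *-mono-≤ (*-monoˡ-≤ X ∣W∣≤G) (≤-refl {G * X}) ⟩
  G * X * (G * X)                        ≤⟨ *-mono-≤ GX≤Y GX≤Y ⟩
  Y * Y                                  ∎
  where
  open ≤-Reasoning
  X Y G : ℕ
  X = p ^ L * s ^ m
  Y = (p + s) ^ n
  G = binomialTail L m
  W : List Str
  W = sublistsOfLength L z
  GX≤Y : G * X ≤ Y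
  GX≤Y = subst (λ k → G * X ≤ (p + s) ^ k) L+m≡n (binomialTail-weighted s≤p L m)
  ∣W∣≤G : length W ≤ G
  ∣W∣≤G = length-sublistsOfLength≤binomialTail L m z (trans ∣z∣≡n (sym L+m≡n))
  bounded : ∀ {w} → w ∈ W → supersequenceCount w n ≤ G
  bounded {w} w∈ = subst₂ (λ k l → supersequenceCount w k ≤ binomialTail l m)
                           (trans (cong (_+ m) ∣w∣≡L) L+m≡n) ∣w∣≡L (supersequenceCount≤binomialTail w m)
    where
    ∣w∣≡L : length w ≡ L
    ∣w∣≡L = ∈sublistsOfLength⇒length L z w∈

x^[1+q]+q*x^q≤x*[1+x]^q : ∀ x q → x ^ suc q + q * x ^ q ≤ x * suc x ^ q
x^[1+q]+q*x^q≤x*[1+x]^q x zero    = ≤-reflexive (+-identityʳ (x * 1))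
x^[1+q]+q*x^q≤x*[1+x]^q x (suc q) = begin
  x * (x * x ^ q) + suc q * (x * x ^ q)               ≤⟨ m≤m+n _ (q * x ^ q) ⟩
  x * (x * x ^ q) + suc q * (x * x ^ q) + q * x ^ q   ≡⟨ factor x q (x ^ q) ⟩
  suc x * (x ^ suc q + q * x ^ q)                     ≤⟨ *-monoʳ-≤ (suc x) (x^[1+q]+q*x^q≤x*[1+x]^q x q) ⟩
  suc x * (x * suc x ^ q)                             ≡⟨ x∙yz≡y∙xz (suc x) x (suc x ^ q) ⟩
  x * suc x ^ suc q                                   ∎
  where
  open ≤-Reasoning
  factor : ∀ x q y → x * (x * y) + suc q * (x * y) + q * y ≡ suc x * (x * y + q * y)
  factor = solve-∀
  x∙yz≡y∙xz : ∀ x y z → x * (y * z) ≡ y * (x * z)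
  x∙yz≡y∙xz = solve-∀

q*x^q≤x*y^q : ∀ {x y} q → x < y → q * x ^ q ≤ x * y ^ q
q*x^q≤x*y^q {x} {y} q x<y = begin
  q * x ^ q                 ≤⟨ m≤n+m _ (x ^ suc q) ⟩
  x ^ suc q + q * x ^ q     ≤⟨ x^[1+q]+q*x^q≤x*[1+x]^q x q ⟩
  x * suc x ^ q             ≤⟨ *-monoʳ-≤ x (^-monoˡ-≤ q x<y) ⟩
  x * y ^ q                 ∎
  where open ≤-Reasoning

J*x^[1+q]≤y^q : ∀ {x y} J q → x < y → J * x * x ≤ q → J * x ^ suc q ≤ y ^ q
J*x^[1+q]≤y^q {zero}  J q _   _ = ≤-trans (≤-reflexive (*-zeroʳ J)) z≤n
J*x^[1+q]≤y^q {x@(suc _)} {y} J q x<y Jxx≤q = *-cancelˡ-≤ x (begin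
  x * (J * (x * x ^ q))  ≡⟨ regroup x J (x ^ q) ⟩
  J * x * x * x ^ q      ≤⟨ *-monoˡ-≤ (x ^ q) Jxx≤q ⟩
  q * x ^ q              ≤⟨ q*x^q≤x*y^q q x<y ⟩
  x * y ^ q              ∎)
  where
  open ≤-Reasoning
  regroup : ∀ x J z → x * (J * (x * z)) ≡ J * x * x * z
  regroup = solve-∀

-- In rational terms: T / (n E) ≤ L / n + S / E ≤ (B / A + b / n) + 1 / (2 K) ≤ B / A + 1 / K.
K*A*T≤[B*K+A]*[n*E] : ∀ A B K {b n E T L S} → T ≤ E * L + n * S → 2 * K * S ≤ E → 2 * K * b ≤ n →
                      A * L ≤ B * n + A * b → K * A * T ≤ (B * K + A) * (n * E)
K*A*T≤[B*K+A]*[n*E] A B K {b} {n} {E} {T} {L} {S} T≤ 2KS≤E 2Kb≤n AL≤ = *-cancelˡ-≤ 2 (begin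
  2 * (K * A * T)                                         ≤⟨ *-monoʳ-≤ 2 (*-monoʳ-≤ (K * A) T≤) ⟩
  2 * (K * A * (E * L + n * S))                           ≡⟨ expand K A E L n S ⟩
  2 * K * E * (A * L) + A * n * (2 * K * S)               ≤⟨ +-mono-≤ (*-monoʳ-≤ (2 * K * E) AL≤) (*-monoʳ-≤ (A * n) 2KS≤E) ⟩
  2 * K * E * (B * n + A * b) + A * n * E                 ≡⟨ regroup K E B n A b ⟩
  2 * (B * K * (n * E)) + A * E * (2 * K * b) + A * n * E ≤⟨ +-monoˡ-≤ (A * n * E) (+-monoʳ-≤ _ (*-monoʳ-≤ (A * E) 2Kb≤n)) ⟩
  2 * (B * K * (n * E)) + A * E * n + A * n * E           ≡⟨ collect B K n E A ⟩
  2 * ((B * K + A) * (n * E))                             ∎)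
  where
  open ≤-Reasoning
  expand : ∀ K A E L n S → 2 * (K * A * (E * L + n * S)) ≡ 2 * K * E * (A * L) + A * n * (2 * K * S)
  expand = solve-∀
  regroup : ∀ K E B n A b → 2 * K * E * (B * n + A * b) + A * n * E ≡ 2 * (B * K * (n * E)) + A * E * (2 * K * b) + A * n * E
  regroup = solve-∀
  collect : ∀ B K n E A → 2 * (B * K * (n * E)) + A * E * n + A * n * E ≡ 2 * ((B * K + A) * (n * E))
  collect = solve-∀

module Rate (p s : ℕ) {{p≢0 : NonZero p}} {{s≢0 : NonZero s}} where

  b : ℕ
  b = p + s

  instance
    b≢0 : NonZero b
    b≢0 = >-nonZero (≤-trans (>-nonZero⁻¹ s) (m≤n+m s p))

  U V : ℕ
  U = p ^ p * s ^ s
  V = b ^ b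

  -- Cleared of logarithms, 2 H(p / b) < 1 for the binary entropy H.
  EntropyCondition : Set
  EntropyCondition = V * V < 2 ^ b * (U * U)

  -- The threshold length is L = p q + r where n = q b + r, so L / n tends to p / b.
  module Split (n : ℕ) where

    q r L m : ℕ
    q = n / b
    r = n % b
    L = p * q + r
    m = s * q

    n≡r+q*b : n ≡ r + q * b
    n≡r+q*b = m≡m%n+[m/n]*n n b

    L+m≡n : L + m ≡ n
    L+m≡n = trans (regroup p q r s) (sym n≡r+q*b)
      where
      regroup : ∀ p q r s → p * q + r + s * q ≡ r + q * (p + s)
      regroup = solve-∀

    *-L≤ : ∀ A B → A * p ≤ B * b → A * L ≤ B * n + A * b
    *-L≤ A B Ap≤Bb = begin
      A * (p * q + r)       ≡⟨ *-distribˡ-+ A (p * q) r ⟩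
      A * (p * q) + A * r   ≡⟨ cong (_+ A * r) (sym (*-assoc A p q)) ⟩
      A * p * q + A * r     ≤⟨ +-mono-≤ (*-monoˡ-≤ q Ap≤Bb) (*-monoʳ-≤ A (<⇒≤ (m%n<n n b))) ⟩
      B * b * q + A * b     ≡⟨ cong (_+ A * b) (trans (*-assoc B b q) (cong (B *_) (*-comm b q))) ⟩
      B * (q * b) + A * b   ≤⟨ +-monoˡ-≤ (A * b) (*-monoʳ-≤ B (m/n*n≤m n b)) ⟩
      B * n + A * b         ∎
      where open ≤-Reasoning

    U^q≤p^L*s^m : U ^ q ≤ p ^ L * s ^ m
    U^q≤p^L*s^m = begin
      (p ^ p * s ^ s) ^ q       ≡⟨ ^-distribʳ-* (p ^ p) (s ^ s) q ⟩
      (p ^ p) ^ q * (s ^ s) ^ q ≡⟨ cong₂ _*_ (^-*-assoc p p q) (^-*-assoc s s q) ⟩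
      p ^ (p * q) * s ^ m       ≤⟨ *-monoˡ-≤ (s ^ m) (^-monoʳ-≤ p (m≤m+n (p * q) r)) ⟩
      p ^ L * s ^ m             ∎
      where open ≤-Reasoning

    b^n≤V^[1+q] : b ^ n ≤ V ^ suc q
    b^n≤V^[1+q] = begin
      b ^ n            ≤⟨ ^-monoʳ-≤ b n≤b*[1+q] ⟩
      b ^ (b * suc q)  ≡⟨ sym (^-*-assoc b b (suc q)) ⟩
      V ^ suc q        ∎
      where
      open ≤-Reasoning
      n≤b*[1+q] : n ≤ b * suc q
      n≤b*[1+q] = begin
        n             ≡⟨ n≡r+q*b ⟩
        r + q * b     ≤⟨ +-monoˡ-≤ (q * b) (<⇒≤ (m%n<n n b)) ⟩
        b + q * b     ≡⟨ *-comm (suc q) b ⟩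
        b * suc q     ∎

    2^[b*q]≤2^n : 2 ^ (b * q) ≤ 2 ^ n
    2^[b*q]≤2^n = ^-monoʳ-≤ 2 (≤-trans (≤-reflexive (*-comm b q)) (m/n*n≤m n b))

  J*lcsCount≥≤2^n : s ≤ p → EntropyCondition → ∀ J n z → length z ≡ n → J * (V * V) * (V * V) ≤ n / b →
                    J * lcsCount≥ (Split.L n) n z ≤ 2 ^ n
  J*lcsCount≥≤2^n s≤p entropy J n z ∣z∣≡n JVV≤q = *-cancelʳ-≤ (J * S) (2 ^ n) (Uq * Uq) {{Uq*Uq≢0}} (begin
    J * S * (Uq * Uq)             ≤⟨ *-monoʳ-≤ (J * S) (*-mono-≤ U^q≤p^L*s^m U^q≤p^L*s^m) ⟩
    J * S * (X * X)               ≡⟨ *-assoc J S (X * X) ⟩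
    J * (S * (X * X))             ≤⟨ *-monoʳ-≤ J (lcsCount≥-weighted s≤p z L+m≡n ∣z∣≡n) ⟩
    J * (b ^ n * b ^ n)           ≤⟨ *-monoʳ-≤ J (*-mono-≤ b^n≤V^[1+q] b^n≤V^[1+q]) ⟩
    J * (V ^ suc q * V ^ suc q)   ≡⟨ cong (J *_) (sym (^-distribʳ-* V V (suc q))) ⟩
    J * (V * V) ^ suc q           ≤⟨ J*x^[1+q]≤y^q J q entropy JVV≤q ⟩
    (2 ^ b * (U * U)) ^ q         ≡⟨ ^-distribʳ-* (2 ^ b) (U * U) q ⟩
    (2 ^ b) ^ q * (U * U) ^ q     ≡⟨ cong₂ _*_ (^-*-assoc 2 b q) (^-distribʳ-* U U q) ⟩
    2 ^ (b * q) * (Uq * Uq)       ≤⟨ *-monoˡ-≤ (Uq * Uq) 2^[b*q]≤2^n ⟩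
    2 ^ n * (Uq * Uq)             ∎)
    where
    open ≤-Reasoning
    open Split n
    S X Uq : ℕ
    S = lcsCount≥ L n z
    X = p ^ L * s ^ m
    Uq = U ^ q
    Uq*Uq≢0 : NonZero (Uq * Uq)
    Uq*Uq≢0 = m*n≢0 Uq Uq {{Uq≢0}} {{Uq≢0}}
      where
      Uq≢0 : NonZero Uq
      Uq≢0 = m^n≢0 U q {{m*n≢0 (p ^ p) (s ^ s) {{m^n≢0 p p}} {{m^n≢0 s s}}}}

  threshold : ℕ → ℕ
  threshold K = 2 * K * b + b * (2 * K * (V * V) * (V * V))

  mean-lcs≤ : s ≤ p → EntropyCondition → ∀ A B → A * p ≤ B * b → ∀ K n → threshold K ≤ n →
              ∀ z → length z ≡ n → K * A * totalLCS n z ≤ (B * K + A) * (n * 2 ^ n)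
  mean-lcs≤ s≤p entropy A B Ap≤Bb K n N≤n z ∣z∣≡n =
    K*A*T≤[B*K+A]*[n*E] A B K (totalLCS≤ n z L) (J*lcsCount≥≤2^n s≤p entropy (2 * K) n z ∣z∣≡n q-large)
                        (≤-trans (m≤m+n _ _) N≤n) (*-L≤ A B Ap≤Bb)
    where
    open Split n
    c : ℕ
    c = 2 * K * (V * V) * (V * V)
    q-large : c ≤ q
    q-large = ≤-trans (≤-reflexive (sym (m*n/n≡m c b)))
                      (/-monoˡ-≤ b (≤-trans (≤-reflexive (*-comm c b)) (≤-trans (m≤n+m _ _) N≤n)))

open Rate 364 45 using (threshold; mean-lcs≤)

-- 364 / 409 ≈ 0.889976 < 0.88999, and 2 H(364 / 409) ≈ 0.99998 < 1.
claimA1 : (k : ℕ) → ∃[ N ] ((n : ℕ) → N ≤ n → (z : Str) → length z ≡ n →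
            suc k * 100000 * totalLCS n z ≤ (88999 * suc k + 100000) * (n * 2 ^ n))
claimA1 k = threshold (suc k) , mean-lcs≤ (≤ᵇ⇒≤ 45 364 _) (≤ᵇ⇒≤ _ _ _) 100000 88999 (≤ᵇ⇒≤ _ _ _) (suc k)
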